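{- The rule $\Box^{+}_{T}$ (from $\Box\alpha,\Box\Sigma|\Gamma,\alpha\Rightarrow\Delta$ infer $\Box\Sigma|\Gamma,\Box\alpha\Rightarrow\Delta$) is height-preserving invertible in $G^{+}_{Grz}$: whenever $\Box\Sigma|\Gamma,\Box\alpha\Rightarrow\Delta$ has a proof in $G^{+}_{Grz}$, the sequent $\Box\alpha,\Box\Sigma|\Gamma,\alpha\Rightarrow\Delta$ has a proof of at most the same height.
   Context: Formulas are built from propositional variables and $\bot$ by $\neg,\wedge,\vee,\Box$; $\alpha\to\beta:=\neg\alpha\vee\beta$; $\Box\Gamma$ is the multiset $\Gamma$ with each element prefixed by $\Box$; $D(\alpha):=\Box(\alpha\to\Box\alpha)$. Sequents of $G^{+}_{Grz}$ have the form $\Box\Sigma|\Gamma\Rightarrow\Delta$ with $\Sigma,\Gamma,\Delta$ finite multisets of formulas. Axioms: $\Box\Sigma|\Gamma,p\Rightarrow p,\Delta$ ($p$ a propositional variable) and $\Box\Sigma|\Gamma,\bot\Rightarrow\Delta$. Propositional rules (with $\Box\Sigma$ unchanged): $\wedge$-l from $\Box\Sigma|\Gamma,\alpha,\beta\Rightarrow\Delta$ to $\Box\Sigma|\Gamma,\alpha\wedge\beta\Rightarrow\Delta$; $\vee$-r from $\Box\Sigma|\Gamma\Rightarrow\alpha,\beta,\Delta$ to $\Box\Sigma|\Gamma\Rightarrow\alpha\vee\beta,\Delta$; $\neg$-r from $\Box\Sigma|\Gamma,\alpha\Rightarrow\Delta$ to $\Box\Sigma|\Gamma\Rightarrow\neg\alpha,\Delta$;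 $\neg$-l from $\Box\Sigma|\Gamma\Rightarrow\alpha,\Delta$ to $\Box\Sigma|\Gamma,\neg\alpha\Rightarrow\Delta$; $\wedge$-r from $\Box\Sigma|\Gamma\Rightarrow\alpha,\Delta$ and $\Box\Sigma|\Gamma\Rightarrow\beta,\Delta$ to $\Box\Sigma|\Gamma\Rightarrow\alpha\wedge\beta,\Delta$; $\vee$-l from $\Box\Sigma|\Gamma,\alpha\Rightarrow\Delta$ and $\Box\Sigma|\Gamma,\beta\Rightarrow\Delta$ to $\Box\Sigma|\Gamma,\alpha\vee\beta\Rightarrow\Delta$. Modal rules: $\Box^{+}_{T}$ as in the claim; $\Box^{+}_{Grz1}$: from $\Box\Gamma|\emptyset\Rightarrow\alpha$ infer $\Box\Gamma|\Pi\Rightarrow\Box\alpha,\Delta$ provided $D(\alpha)\in\Box\Gamma$; $\Box^{+}_{Grz2}$: from $\Box\Gamma,D(\alpha)|\Gamma\Rightarrow\alpha$ infer $\Box\Gamma|\Pi\Rightarrow\Box\alpha,\Delta$ provided $D(\alpha)\notin\Box\Gamma$; in both, $\Pi$ contains only propositional variables and $\Delta$ only propositional variables and boxed formulas. The height of a proof is the height of its tree. -}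

module Defs where

open import Data.Nat using (ℕ; suc; _⊔_)
open import Data.List using (List; []; _∷_)
open import Data.List.Relation.Unary.All using (All)
open import Data.List.Membership.Propositional using (_∈_)
open import Data.List.Relation.Binary.Permutation.Propositional using (_↭_)
open import Relation.Nullary using (¬_)

data Fm : Set where
  var  : ℕ → Fm
  ⊥'   : Fm
  ¬'_  : Fm → Fm
  _∧'_ : Fm → Fm → Fm
  _∨'_ : Fm → Fm → Fm
  □_   : Fm → Fm

infixr 6 _∧'_
infixr 5 _∨'_

_⇒'_ : Fm → Fm → Fm
α ⇒' β = (¬' α) ∨' β

-- D(α) = □(α → □α); we store the *unboxed* body α → □α
Dbody : Fm → Fm
Dbody α = α ⇒' (□ α)

D : Fm → Fm
D α = □ (Dbody α)

-- The field 'boxed' holds Σ (the list of formulas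
-- whose boxes form the left-most multiset □Σ). Multisets are lists; every
-- rule's conclusion is matched up to permutation (_↭_).
record Seq : Set where
  constructor _∣_⇒_
  field
    boxed : List Fm
    ante  : List Fm
    succ  : List Fm

infix 3 _∣_⇒_

data IsVar : Fm → Set where
  isVar : ∀ p → IsVar (var p)

data VarOrBox : Fm → Set where
  vbVar : ∀ p → VarOrBox (var p)
  vbBox : ∀ α → VarOrBox (□ α)

data Proof : Seq → Set where
  ax   : ∀ {Σ Γ Δ Γ' Δ'} p → Γ ↭ (var p ∷ Γ') → Δ ↭ (var p ∷ Δ') →
         Proof (Σ ∣ Γ ⇒ Δ)
  ax⊥  : ∀ {Σ Γ Δ Γ'} → Γ ↭ (⊥' ∷ Γ') → Proof (Σ ∣ Γ ⇒ Δ)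
  ∧l   : ∀ {Σ Γ Δ Γ'} α β → Γ ↭ ((α ∧' β) ∷ Γ') →
         Proof (Σ ∣ α ∷ β ∷ Γ' ⇒ Δ) → Proof (Σ ∣ Γ ⇒ Δ)
  ∨r   : ∀ {Σ Γ Δ Δ'} α β → Δ ↭ ((α ∨' β) ∷ Δ') →
         Proof (Σ ∣ Γ ⇒ α ∷ β ∷ Δ') → Proof (Σ ∣ Γ ⇒ Δ)
  ¬r   : ∀ {Σ Γ Δ Δ'} α → Δ ↭ ((¬' α) ∷ Δ') →
         Proof (Σ ∣ α ∷ Γ ⇒ Δ') → Proof (Σ ∣ Γ ⇒ Δ)
  ¬l   : ∀ {Σ Γ Δ Γ'} α → Γ ↭ ((¬' α) ∷ Γ') →
         Proof (Σ ∣ Γ' ⇒ α ∷ Δ) → Proof (Σ ∣ Γ ⇒ Δ)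
  ∧r   : ∀ {Σ Γ Δ Δ'} α β → Δ ↭ ((α ∧' β) ∷ Δ') →
         Proof (Σ ∣ Γ ⇒ α ∷ Δ') → Proof (Σ ∣ Γ ⇒ β ∷ Δ') →
         Proof (Σ ∣ Γ ⇒ Δ)
  ∨l   : ∀ {Σ Γ Δ Γ'} α β → Γ ↭ ((α ∨' β) ∷ Γ') →
         Proof (Σ ∣ α ∷ Γ' ⇒ Δ) → Proof (Σ ∣ β ∷ Γ' ⇒ Δ) →
         Proof (Σ ∣ Γ ⇒ Δ)
  □T   : ∀ {Σ Γ Δ Γ'} α → Γ ↭ ((□ α) ∷ Γ') →
         Proof (α ∷ Σ ∣ α ∷ Γ' ⇒ Δ) → Proof (Σ ∣ Γ ⇒ Δ)
  □Grz1 : ∀ {Σ Π Δ Δ'} α → Δ ↭ ((□ α) ∷ Δ') →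
          All IsVar Π → All VarOrBox Δ' → Dbody α ∈ Σ →
          Proof (Σ ∣ [] ⇒ α ∷ []) → Proof (Σ ∣ Π ⇒ Δ)
  □Grz2 : ∀ {Σ Π Δ Δ'} α → Δ ↭ ((□ α) ∷ Δ') →
          All IsVar Π → All VarOrBox Δ' → ¬ (Dbody α ∈ Σ) →
          Proof (Dbody α ∷ Σ ∣ Σ ⇒ α ∷ []) → Proof (Σ ∣ Π ⇒ Δ)

height : ∀ {S} → Proof S → ℕ
height (ax _ _ _) = 1
height (ax⊥ _) = 1
height (∧l _ _ _ d) = suc (height d)
height (∨r _ _ _ d) = suc (height d)
height (¬r _ _ d) = suc (height d)
height (¬l _ _ d) = suc (height d)
height (∧r _ _ _ d e) = suc (height d ⊔ height e)
height (∨l _ _ _ d e) = suc (height d ⊔ height e)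
height (□T _ _ d) = suc (height d)
height (□Grz1 _ _ _ _ _ d) = suc (height d)
height (□Grz2 _ _ _ _ _ d) = suc (height d)

-- Height-preserving exchange lets us read sequents as multisets. If □α is principal, the last rule is □⁺_T and
-- its premise is already the desired sequent. Otherwise □α is a side formula:
-- the Grz rules cannot occur, since their conclusions have only variables on the
-- left, and every other rule passes □α (with Σ) unchanged to its premises, so we
-- invert there and reapply the rule.
module Submission where

open import Defs
open import Data.Nat using (_≤_; _⊔_; suc; s≤s)
open import Data.Nat.Properties using (≤-refl; ≤-trans; ≤-reflexive; ⊔-mono-≤; n≤1+n)
open import Data.List using (List; _∷_; _++_)
open import Data.List.Relation.Unary.All using (All; _∷_)
open import Data.List.Relation.Unary.Any using (here; there)
open import Data.List.Membership.Propositional.Properties using (∈-∃++)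
open import Data.List.Relation.Binary.Permutation.Propositional
open import Data.List.Relation.Binary.Permutation.Propositional.Properties
  using (∈-resp-↭; All-resp-↭; drop-∷; shift)
open import Data.Product using (Σ-syntax; ∃-syntax; _×_; _,_)
open import Data.Sum using (_⊎_; inj₁; inj₂)
open import Data.Empty using (⊥; ⊥-elim)
open import Relation.Binary.PropositionalEquality using (_≡_; refl; cong; cong₂)

module _ {A : Set} where

  prep-swap : ∀ {xs ys : List A} {a} b → xs ↭ a ∷ ys → b ∷ xs ↭ a ∷ b ∷ ys
  prep-swap b p = ↭-trans (prep b p) (swap b _ ↭-refl)

  ∷-↭-∷-cases : ∀ {ys zs : List A} {a b} → a ∷ ys ↭ b ∷ zs →
                (a ≡ b × ys ↭ zs) ⊎ (∃[ ws ] (ys ↭ b ∷ ws × zs ↭ a ∷ ws))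
  ∷-↭-∷-cases {a = a} {b} p with ∈-resp-↭ (↭-sym p) (here refl)
  ... | here refl = inj₁ (refl , drop-∷ p)
  ... | there b∈ys with ∈-∃++ b∈ys
  ... | us , vs , refl =
    inj₂ (us ++ vs , shift b us vs , drop-∷ (↭-trans (↭-sym p) (shift b (a ∷ us) vs)))

  ↭-∷-split : ∀ {xs ys zs : List A} {a b} → xs ↭ a ∷ ys → xs ↭ b ∷ zs →
              (a ≡ b × ys ↭ zs) ⊎ (∃[ ws ] (ys ↭ b ∷ ws × zs ↭ a ∷ ws))
  ↭-∷-split p q = ∷-↭-∷-cases (↭-trans (↭-sym p) q)

exchange : ∀ {Σ Γ Δ Σ' Γ' Δ'} (d : Proof (Σ ∣ Γ ⇒ Δ)) →
           Σ ↭ Σ' → Γ ↭ Γ' → Δ ↭ Δ' →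
           Σ[ e ∈ Proof (Σ' ∣ Γ' ⇒ Δ') ] height e ≡ height d
exchange (ax p g r) pΣ pΓ pΔ = ax p (↭-trans (↭-sym pΓ) g) (↭-trans (↭-sym pΔ) r) , refl
exchange (ax⊥ g) pΣ pΓ pΔ = ax⊥ (↭-trans (↭-sym pΓ) g) , refl
exchange (∧l α β g d) pΣ pΓ pΔ with exchange d pΣ ↭-refl pΔ
... | e , h = ∧l α β (↭-trans (↭-sym pΓ) g) e , cong suc h
exchange (∨r α β r d) pΣ pΓ pΔ with exchange d pΣ pΓ ↭-refl
... | e , h = ∨r α β (↭-trans (↭-sym pΔ) r) e , cong suc h
exchange (¬r α r d) pΣ pΓ pΔ with exchange d pΣ (prep α pΓ) ↭-refl
... | e , h = ¬r α (↭-trans (↭-sym pΔ) r) e , cong suc h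
exchange (¬l α g d) pΣ pΓ pΔ with exchange d pΣ ↭-refl (prep α pΔ)
... | e , h = ¬l α (↭-trans (↭-sym pΓ) g) e , cong suc h
exchange (∧r α β r d₁ d₂) pΣ pΓ pΔ with exchange d₁ pΣ pΓ ↭-refl | exchange d₂ pΣ pΓ ↭-refl
... | e₁ , h₁ | e₂ , h₂ = ∧r α β (↭-trans (↭-sym pΔ) r) e₁ e₂ , cong suc (cong₂ _⊔_ h₁ h₂)
exchange (∨l α β g d₁ d₂) pΣ pΓ pΔ with exchange d₁ pΣ ↭-refl pΔ | exchange d₂ pΣ ↭-refl pΔ
... | e₁ , h₁ | e₂ , h₂ = ∨l α β (↭-trans (↭-sym pΓ) g) e₁ e₂ , cong suc (cong₂ _⊔_ h₁ h₂)
exchange (□T α g d) pΣ pΓ pΔ with exchange d (prep α pΣ) ↭-refl pΔ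
... | e , h = □T α (↭-trans (↭-sym pΓ) g) e , cong suc h
exchange (□Grz1 α r π δ m d) pΣ pΓ pΔ with exchange d pΣ ↭-refl ↭-refl
... | e , h = □Grz1 α (↭-trans (↭-sym pΔ) r) (All-resp-↭ pΓ π) δ (∈-resp-↭ pΣ m) e , cong suc h
exchange (□Grz2 α r π δ m d) pΣ pΓ pΔ with exchange d (prep _ pΣ) pΣ ↭-refl
... | e , h = □Grz2 α (↭-trans (↭-sym pΔ) r) (All-resp-↭ pΓ π) δ
                (λ m' → m (∈-resp-↭ (↭-sym pΣ) m')) e , cong suc h

boxed∉vars : ∀ {Π Γ α} → Π ↭ □ α ∷ Γ → All IsVar Π → ⊥
boxed∉vars q π with All-resp-↭ q π
... | () ∷ _

-- Stating all three contexts up to permutation lets the induction hypothesis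
-- apply to every premise directly.
□T-inversion : ∀ {Σ Σ' Γ₀ Γ Γ' Δ α} (d : Proof (Σ ∣ Γ₀ ⇒ Δ)) →
               Γ₀ ↭ □ α ∷ Γ → Σ' ↭ α ∷ Σ → Γ' ↭ α ∷ Γ →
               Σ[ e ∈ Proof (Σ' ∣ Γ' ⇒ Δ) ] height e ≤ height d
□T-inversion {α = α} (ax p g r) q s t with ↭-∷-split q g
... | inj₁ (() , _)
... | inj₂ (_ , u , _) = ax p (↭-trans t (prep-swap α u)) r , ≤-refl
□T-inversion {α = α} (ax⊥ g) q s t with ↭-∷-split q g
... | inj₁ (() , _)
... | inj₂ (_ , u , _) = ax⊥ (↭-trans t (prep-swap α u)) , ≤-refl
□T-inversion {α = α} (∧l β γ g d) q s t with ↭-∷-split q g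
... | inj₁ (() , _)
... | inj₂ (_ , u , v)
    with □T-inversion d (prep-swap β (prep-swap γ v)) s (prep-swap β (prep-swap γ ↭-refl))
... | e , h = ∧l β γ (↭-trans t (prep-swap α u)) e , s≤s h
□T-inversion (∨r β γ r d) q s t with □T-inversion d q s t
... | e , h = ∨r β γ r e , s≤s h
□T-inversion (¬r β r d) q s t with □T-inversion d (prep-swap β q) s (prep-swap β t)
... | e , h = ¬r β r e , s≤s h
□T-inversion {α = α} (¬l β g d) q s t with ↭-∷-split q g
... | inj₁ (() , _)
... | inj₂ (_ , u , v) with □T-inversion d v s ↭-refl
... | e , h = ¬l β (↭-trans t (prep-swap α u)) e , s≤s h
□T-inversion (∧r β γ r d₁ d₂) q s t with □T-inversion d₁ q s t | □T-inversion d₂ q s t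
... | e₁ , h₁ | e₂ , h₂ = ∧r β γ r e₁ e₂ , s≤s (⊔-mono-≤ h₁ h₂)
□T-inversion {α = α} (∨l β γ g d₁ d₂) q s t with ↭-∷-split q g
... | inj₁ (() , _)
... | inj₂ (_ , u , v)
    with □T-inversion d₁ (prep-swap β v) s (prep-swap β ↭-refl)
       | □T-inversion d₂ (prep-swap γ v) s (prep-swap γ ↭-refl)
... | e₁ , h₁ | e₂ , h₂ = ∨l β γ (↭-trans t (prep-swap α u)) e₁ e₂ , s≤s (⊔-mono-≤ h₁ h₂)
□T-inversion {α = α} (□T β g d) q s t with ↭-∷-split q g
... | inj₁ (refl , u) with exchange d (↭-sym s) (↭-sym (↭-trans t (prep α u))) ↭-refl
... | e , h = e , ≤-trans (≤-reflexive h) (n≤1+n _)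
□T-inversion {α = α} (□T β g d) q s t | inj₂ (_ , u , v)
    with □T-inversion d (prep-swap β v) (prep-swap β s) (prep-swap β ↭-refl)
... | e , h = □T β (↭-trans t (prep-swap α u)) e , s≤s h
□T-inversion (□Grz1 _ _ π _ _ _) q _ _ = ⊥-elim (boxed∉vars q π)
□T-inversion (□Grz2 _ _ π _ _ _) q _ _ = ⊥-elim (boxed∉vars q π)

lemma2p7 : (Σs Γ Δ : List Fm) (α : Fm) (d : Proof (Σs ∣ (□ α) ∷ Γ ⇒ Δ)) →
    Σ[ e ∈ Proof (α ∷ Σs ∣ α ∷ Γ ⇒ Δ) ] (height e ≤ height d)
lemma2p7 _ _ _ _ d = □T-inversion d ↭-refl ↭-refl ↭-refl
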